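{- Let $D$ be a weakly connected digraph with $k$ sources for some positive integer $k$, and suppose that for some positive integer $m$ the $m$-step competition graph $C^m(D)$ is triangle-free and has $l$ components. Then (1) $l \geq k$; and (2) if $l = k$, then each non-source vertex of $D$ is an $m$-step prey of exactly two vertices of $D$, and shares at most one common $m$-step predator with any vertex distinct from itself.
   Context: All digraphs are finite, may have loops, and (standing assumption) every vertex has outdegree at least $1$. For a positive integer $m$, a vertex $y$ is an $m$-step prey of $x$ (and $x$ an $m$-step predator of $y$) if there is a directed walk of length $m$ from $x$ to $y$. The $m$-step competition graph $C^m(D)$ has vertex set $V(D)$ and an edge between distinct vertices $x,y$ iff they have a common $m$-step prey. A source is a vertex of indegree $0$. $D$ is weakly connected if its underlying undirected graph is connected. -}

module Defs where

open import Data.Nat using (ℕ; zero; suc)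
open import Data.Fin using (Fin)
open import Data.Fin.Properties using (all?)
open import Data.Bool using (Bool; true; false)
open import Data.Bool.Properties using () renaming (_≟_ to _≟ᵇ_)
open import Data.List using (List; filter; length; allFin)
open import Data.Product using (Σ; ∃; _×_; _,_)
open import Data.Sum using (_⊎_)
open import Relation.Nullary using (¬_)
open import Relation.Binary.PropositionalEquality using (_≡_; _≢_)
open import Relation.Binary.Construct.Closure.ReflexiveTransitive using (Star)

-- A digraph on the vertex set Fin n, given by its (Boolean) arc relation.
-- Loops are allowed (E x x may be true).
Digraph : ℕ → Set
Digraph n = Fin n → Fin n → Bool

module _ {n : ℕ} (E : Digraph n) where

  Arc : Fin n → Fin n → Set
  Arc x y = E x y ≡ true

  OutdegPos : Set
  OutdegPos = ∀ x → ∃ λ y → Arc x y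

  data Walk : ℕ → Fin n → Fin n → Set where
    here : ∀ {x} → Walk zero x x
    step : ∀ {m x y z} → Arc x y → Walk m y z → Walk (suc m) x z

  Prey : ℕ → Fin n → Fin n → Set
  Prey m y x = Walk m x y

  IsSource : Fin n → Set
  IsSource x = ∀ y → E y x ≡ false

  sources : List (Fin n)
  sources = filter (λ x → all? (λ y → E y x ≟ᵇ false)) (allFin n)

  #sources : ℕ
  #sources = length sources

  UArc : Fin n → Fin n → Set
  UArc x y = Arc x y ⊎ Arc y x

  WeaklyConnected : Set
  WeaklyConnected = ∀ x y → Star UArc x y

  CompEdge : ℕ → Fin n → Fin n → Set
  CompEdge m x y = x ≢ y × ∃ λ z → Walk m x z × Walk m y z

module _ {n : ℕ} (G : Fin n → Fin n → Set) where

  TriangleFree : Set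
  TriangleFree = ∀ x y z → ¬ (G x y × G y z × G x z)

  Connected : Fin n → Fin n → Set
  Connected = Star G

  -- G has exactly l connected components: there is a surjective labelling
  -- of the vertices by Fin l whose fibres are exactly the components.
  HasComponents : ℕ → Set
  HasComponents l =
    Σ (Fin n → Fin l) λ c →
      (∀ i → ∃ λ x → c x ≡ i) ×
      (∀ x y → (c x ≡ c y → Connected x y) × (Connected x y → c x ≡ c y))

-- Let L be the list of non-source vertices.  In a triangle-free C^m(D) every vertex z
-- has at most two m-step predators, so the edges of C^m(D) are covered by the |L|
-- pairs {first two m-step predators of z}, z ∈ L (an m-step prey is never a source).
-- A graph with n vertices and e edges has at least n − e components, hence
-- l ≥ n − |L| = k.  If l = k the bound is tight, so every one of these pairs is a
-- bridge of the remaining ones: the pair of a non-source v is a proper edge (v has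
-- exactly two predators) and no other vertex has the same two predators.
module Submission where

open import Defs
open import Data.Nat using (ℕ; _≥_; _≤_; _>_; zero; suc; _+_; z≤n; s≤s)
open import Data.Nat.Properties using (module ≤-Reasoning; ≤-trans; m≤m+n; +-suc; +-monoʳ-≤; n≤1+n; +-cancelʳ-≤; +-cancelˡ-≤; 1+n≰n)
open import Data.Fin using (Fin; punchIn; punchOut; _≟_)
open import Data.Fin.Properties using (injective⇒≤; punchOut-cong; punchOut-punchIn; punchInᵢ≢i; any?; all?)
open import Data.Bool using (true; false)
open import Data.Bool.Properties using () renaming (_≟_ to _≟ᵇ_)
open import Data.List using (List; []; _∷_; [_]; map; length; filter; allFin; _++_)
open import Data.List.Properties using (map-id; map-∘; length-tabulate; length-map)
open import Data.List.Membership.Propositional using (_∈_)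
open import Data.List.Membership.Propositional.Properties using (∈-map⁺; ∈-filter⁺; ∈-filter⁻; ∈-allFin; ∈-∃++)
open import Data.List.Relation.Binary.Subset.Propositional using (_⊆_)
open import Data.List.Relation.Binary.Permutation.Propositional using (_↭_; ↭-sym)
open import Data.List.Relation.Binary.Permutation.Propositional.Properties using (shift; ∈-resp-↭; ↭-length)
open import Data.List.Relation.Unary.Any using (here; there)
open import Data.List.Relation.Unary.All using (_∷_)
open import Data.List.Relation.Unary.AllPairs using (_∷_)
open import Data.List.Relation.Unary.Unique.Propositional using (Unique)
import Data.List.Relation.Unary.Unique.Propositional.Properties as Unique
open import Data.Product using (∃; _×_; _,_; proj₁; proj₂)
import Data.Product as Product
open import Data.Sum using (_⊎_; inj₁; inj₂)
open import Data.Empty using (⊥)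
open import Level using (Level)
open import Function using (_∘_)
open import Relation.Nullary using (¬_; yes; no; Dec; contradiction)
open import Relation.Nullary.Decidable using (_×-dec_)
open import Relation.Unary using (Pred; Decidable)
open import Relation.Unary.Properties using (∁?)
open import Relation.Binary using (Rel; _⇒_; _=[_]⇒_)
open import Relation.Binary.PropositionalEquality using (_≡_; _≢_; refl; sym; trans; cong; subst; subst₂)
open import Relation.Binary.Construct.Closure.Symmetric using (SymClosure; fwd; bwd)
import Relation.Binary.Construct.Closure.Symmetric as SymClosure
open import Relation.Binary.Construct.Closure.ReflexiveTransitive using (Star; ε; _◅_; kleisliStar; _⋆)
import Relation.Binary.Construct.Closure.ReflexiveTransitive as Star

private
  variable
    A : Set
    ℓ : Level

length-filter+length-filter-∁ : {P : Pred A ℓ} (P? : Decidable P) (xs : List A) →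
  length (filter P? xs) + length (filter (∁? P?) xs) ≡ length xs
length-filter+length-filter-∁ P? [] = refl
length-filter+length-filter-∁ P? (x ∷ xs) with P? x
... | yes _ = cong suc (length-filter+length-filter-∁ P? xs)
... | no _  = trans (+-suc _ _) (cong suc (length-filter+length-filter-∁ P? xs))

∈⇒↭∷ : ∀ {x : A} {xs} → x ∈ xs → ∃ λ ys → xs ↭ x ∷ ys
∈⇒↭∷ {x = x} x∈xs with ys , zs , refl ← ∈-∃++ x∈xs = ys ++ zs , shift x ys zs

Unique⇒length≤2 : {xs : List A} → Unique xs →
  (∀ {a b c} → a ∈ xs → b ∈ xs → c ∈ xs → a ≢ b → b ≢ c → a ≢ c → ⊥) → length xs ≤ 2
Unique⇒length≤2 {xs = []} _ _ = z≤n
Unique⇒length≤2 {xs = _ ∷ []} _ _ = s≤s z≤n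
Unique⇒length≤2 {xs = _ ∷ _ ∷ []} _ _ = s≤s (s≤s z≤n)
Unique⇒length≤2 {xs = _ ∷ _ ∷ _ ∷ _} ((a≢b ∷ a≢c ∷ _) ∷ (b≢c ∷ _) ∷ _) no-triangle =
  contradiction a≢c (no-triangle (here refl) (there (here refl)) (there (there (here refl))) a≢b b≢c)

Edge : List (A × A) → Rel A _
Edge L = SymClosure (λ u w → (u , w) ∈ L)

Edge-mono : {L L′ : List (A × A)} → L ⊆ L′ → Edge L ⇒ Edge L′
Edge-mono L⊆L′ = SymClosure.map L⊆L′

Edge-[]-ends : ∀ {p q : A × A} {a b} → Edge [ p ] a b → Edge [ q ] a b → Edge [ q ] (proj₁ p) (proj₂ p)
Edge-[]-ends (fwd (here refl)) e = e
Edge-[]-ends (bwd (here refl)) e = SymClosure.symmetric _ e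

Star-Edge-[] : ∀ {a b : A} → Star (Edge []) a b → a ≡ b
Star-Edge-[] ε = refl
Star-Edge-[] (fwd () ◅ _)
Star-Edge-[] (bwd () ◅ _)

Star-Edge-redundant : ∀ {L : List (A × A)} {e} → Star (Edge L) (proj₁ e) (proj₂ e) →
  Star (Edge (e ∷ L)) ⇒ Star (Edge L)
Star-Edge-redundant {L = L} path = edge⇒path ⋆
  where
  edge⇒path : Edge (_ ∷ L) ⇒ Star (Edge L)
  edge⇒path (fwd (here refl)) = path
  edge⇒path (bwd (here refl)) = Star.reverse (SymClosure.symmetric _) path
  edge⇒path (fwd (there uw)) = fwd uw ◅ ε
  edge⇒path (bwd (there wu)) = bwd wu ◅ ε

Star-Edge-identify : ∀ {B : Set} {x y : A} {L} (f : A → B) → f x ≡ f y →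
  Star (Edge ((x , y) ∷ L)) =[ f ]⇒ Star (Edge (map (Product.map f f) L))
Star-Edge-identify {L = L} f fx≡fy = kleisliStar f edge⇒path
  where
  edge⇒path : Edge (_ ∷ L) =[ f ]⇒ Star (Edge (map (Product.map f f) L))
  edge⇒path (fwd (here refl)) = subst (Star _ _) fx≡fy ε
  edge⇒path (bwd (here refl)) = subst (Star _ _) (sym fx≡fy) ε
  edge⇒path (fwd (there uw)) = fwd (∈-map⁺ _ uw) ◅ ε
  edge⇒path (bwd (there wu)) = bwd (∈-map⁺ _ wu) ◅ ε

module _ {n} {x y : Fin (suc n)} (x≢y : x ≢ y) where

  merge : Fin (suc n) → Fin n
  merge v with v ≟ y
  ... | yes _  = punchOut (x≢y ∘ sym)
  ... | no v≢y = punchOut (v≢y ∘ sym)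

  merge-x≡merge-y : merge x ≡ merge y
  merge-x≡merge-y with x ≟ y | y ≟ y
  ... | yes x≡y | _       = contradiction x≡y x≢y
  ... | no _    | yes _   = punchOut-cong y refl
  ... | no _    | no y≢y = contradiction refl y≢y

  merge-punchIn : ∀ u → merge (punchIn y u) ≡ u
  merge-punchIn u with punchIn y u ≟ y
  ... | yes eq = contradiction eq (punchInᵢ≢i y u)
  ... | no _   = trans (punchOut-cong y refl) (punchOut-punchIn y)

-- Generalising over the renaming f keeps the recursion structural on L: contracting
-- an edge composes f with the contraction instead of mapping the list.
vertices≤labels+mapped-edges : ∀ {B : Set} {n l} (f : B → Fin n) (L : List (B × B)) (c : Fin n → Fin l) →
  (∀ {x y} → c x ≡ c y → Star (Edge (map (Product.map f f) L)) x y) → n ≤ l + length L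
vertices≤labels+mapped-edges {n = zero} _ _ _ _ = z≤n
vertices≤labels+mapped-edges {l = l} f [] c connected =
  ≤-trans (injective⇒≤ (Star-Edge-[] ∘ connected)) (m≤m+n l 0)
vertices≤labels+mapped-edges {n = suc n} {l} f ((x , y) ∷ L) c connected with f x ≟ f y
... | yes fx≡fy = ≤-trans (vertices≤labels+mapped-edges f L c without-loop) (+-monoʳ-≤ l (n≤1+n _))
  where
  without-loop : ∀ {u w} → c u ≡ c w → Star (Edge (map (Product.map f f) L)) u w
  without-loop = Star-Edge-redundant (subst (Star _ (f x)) fx≡fy ε) ∘ connected
... | no fx≢fy = subst (suc n ≤_) (sym (+-suc l (length L)))
                   (s≤s (vertices≤labels+mapped-edges (merge fx≢fy ∘ f) L (c ∘ punchIn (f y)) contracted))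
  where
  contracted : ∀ {u w} → c (punchIn (f y) u) ≡ c (punchIn (f y) w) →
               Star (Edge (map (Product.map (merge fx≢fy ∘ f) (merge fx≢fy ∘ f)) L)) u w
  contracted {u} {w} eq =
    subst₂ (Star (Edge (map _ L))) (merge-punchIn fx≢fy u) (merge-punchIn fx≢fy w)
      (subst (λ L′ → Star (Edge L′) _ _) (sym (map-∘ L))
        (Star-Edge-identify (merge fx≢fy) (merge-x≡merge-y fx≢fy) (connected eq)))

vertices≤labels+edges : ∀ {n l} (L : List (Fin n × Fin n)) (c : Fin n → Fin l) →
  (∀ {x y} → c x ≡ c y → Star (Edge L) x y) → n ≤ l + length L
vertices≤labels+edges L c connected =
  vertices≤labels+mapped-edges Function.id L c (subst (λ L′ → Star (Edge L′) _ _) (sym (map-id L)) ∘ connected)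

firstTwo : A → List A → A × A
firstTwo d []          = d , d
firstTwo _ (a ∷ [])     = a , a
firstTwo _ (a ∷ b ∷ _) = a , b

firstTwo-covers : ∀ d {xs : List A} {x y} → length xs ≤ 2 → x ≢ y → x ∈ xs → y ∈ xs →
  Edge [ firstTwo d xs ] x y
firstTwo-covers _ {_ ∷ []} _ x≢y (here refl) (here refl) = contradiction refl x≢y
firstTwo-covers _ {_ ∷ _ ∷ []} _ x≢y (here refl) (here refl) = contradiction refl x≢y
firstTwo-covers _ {_ ∷ _ ∷ []} _ _ (here refl) (there (here refl)) = fwd (here refl)
firstTwo-covers _ {_ ∷ _ ∷ []} _ _ (there (here refl)) (here refl) = bwd (here refl)
firstTwo-covers _ {_ ∷ _ ∷ []} _ x≢y (there (here refl)) (there (here refl)) = contradiction refl x≢y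
firstTwo-covers _ {_ ∷ _ ∷ _ ∷ _} (s≤s (s≤s ())) _ _ _

firstTwo-proper : ∀ d {xs : List A} → length xs ≤ 2 → proj₁ (firstTwo d xs) ≢ proj₂ (firstTwo d xs) →
  xs ≡ proj₁ (firstTwo d xs) ∷ proj₂ (firstTwo d xs) ∷ []
firstTwo-proper _ {[]} _ loop = contradiction refl loop
firstTwo-proper _ {_ ∷ []} _ loop = contradiction refl loop
firstTwo-proper _ {_ ∷ _ ∷ []} _ _ = refl
firstTwo-proper _ {_ ∷ _ ∷ _ ∷ _} (s≤s (s≤s ())) _

module CompetitionGraph {n} (E : Digraph n) (m : ℕ) where

  walk? : ∀ k x z → Dec (Walk E k x z)
  walk? zero x z with x ≟ z
  ... | yes refl = yes here
  ... | no x≢z   = no λ { here → x≢z refl }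
  walk? (suc k) x z with any? (λ y → (E x y ≟ᵇ true) ×-dec walk? k y z)
  ... | yes (_ , xy , w) = yes (step xy w)
  ... | no ¬w            = no λ { (step xy w) → ¬w (_ , xy , w) }

  prey-¬IsSource : ∀ {k x z} → k > 0 → Walk E k x z → ¬ IsSource E z
  prey-¬IsSource _ (step {x = x} xz here) source = contradiction (trans (sym xz) (source x)) λ ()
  prey-¬IsSource _ (step _ w@(step _ _)) = prey-¬IsSource (s≤s z≤n) w

  nonSources : List (Fin n)
  nonSources = filter (∁? (λ x → all? (λ y → E y x ≟ᵇ false))) (allFin n)

  #sources+#nonSources≡n : #sources E + length nonSources ≡ n
  #sources+#nonSources≡n = trans (length-filter+length-filter-∁ _ (allFin n)) (length-tabulate Function.id)

  ∈-nonSources : ∀ {z} → ¬ IsSource E z → z ∈ nonSources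
  ∈-nonSources {z} = ∈-filter⁺ _ (∈-allFin z)

  predators : Fin n → List (Fin n)
  predators z = filter (λ x → walk? m x z) (allFin n)

  ∈-predators⁺ : ∀ {x z} → Walk E m x z → x ∈ predators z
  ∈-predators⁺ {x} = ∈-filter⁺ _ (∈-allFin x)

  ∈-predators⁻ : ∀ {x z} → x ∈ predators z → Walk E m x z
  ∈-predators⁻ x∈ = proj₂ (∈-filter⁻ _ {xs = allFin n} x∈)

  -- A prey with fewer than two predators contributes a loop, which joins nothing.
  predatorPair : Fin n → Fin n × Fin n
  predatorPair z = firstTwo z (predators z)

  module TriangleFreeness (triangle-free : TriangleFree (CompEdge E m)) where

    predators-length≤2 : ∀ z → length (predators z) ≤ 2
    predators-length≤2 z = Unique⇒length≤2 (Unique.filter⁺ _ (Unique.allFin⁺ n)) λ a b c a≢b b≢c a≢c →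
      triangle-free _ _ _ ( (a≢b , z , ∈-predators⁻ a , ∈-predators⁻ b)
                          , (b≢c , z , ∈-predators⁻ b , ∈-predators⁻ c)
                          , (a≢c , z , ∈-predators⁻ a , ∈-predators⁻ c))

    predatorPair-covers : ∀ {x y z} → x ≢ y → Walk E m x z → Walk E m y z → Edge [ predatorPair z ] x y
    predatorPair-covers x≢y x→z y→z =
      firstTwo-covers _ (predators-length≤2 _) x≢y (∈-predators⁺ x→z) (∈-predators⁺ y→z)

    module Components (m>0 : m > 0) {l} (c : Fin n → Fin l)
                      (c-connected : ∀ {x y} → c x ≡ c y → Star (CompEdge E m) x y) where

      CompEdge⇒Edge : ∀ {zs} → (∀ {z} → ¬ IsSource E z → z ∈ zs) → CompEdge E m ⇒ Edge (map predatorPair zs)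
      CompEdge⇒Edge covers (x≢y , z , x→z , y→z) =
        Edge-mono (λ { (here refl) → ∈-map⁺ predatorPair (covers (prey-¬IsSource m>0 x→z)) })
                  (predatorPair-covers x≢y x→z y→z)

      connected-by-predatorPairs : ∀ {zs} → (∀ {z} → ¬ IsSource E z → z ∈ zs) →
        ∀ {x y} → c x ≡ c y → Star (Edge (map predatorPair zs)) x y
      connected-by-predatorPairs covers = Star.map (CompEdge⇒Edge covers) ∘ c-connected

      vertices≤components+length : ∀ zs → (∀ {x y} → c x ≡ c y → Star (Edge (map predatorPair zs)) x y) →
        n ≤ l + length zs
      vertices≤components+length zs connected =
        subst (λ e → n ≤ l + e) (length-map predatorPair zs) (vertices≤labels+edges _ c connected)

      #sources≤components : #sources E ≤ l
      #sources≤components = +-cancelʳ-≤ (length nonSources) _ _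
        (subst (_≤ l + length nonSources) (sym #sources+#nonSources≡n)
          (vertices≤components+length nonSources (connected-by-predatorPairs ∈-nonSources)))

      module Tight (tight : l ≡ #sources E) {v} (v-prey : ¬ IsSource E v) where

        private
          others : List (Fin n)
          others = proj₁ (∈⇒↭∷ (∈-nonSources v-prey))

          nonSources↭v∷others : nonSources ↭ v ∷ others
          nonSources↭v∷others = proj₂ (∈⇒↭∷ (∈-nonSources v-prey))

          ∈-others : ∀ {w} → ¬ IsSource E w → w ≢ v → w ∈ others
          ∈-others w-prey w≢v with ∈-resp-↭ nonSources↭v∷others (∈-nonSources w-prey)
          ... | here w≡v = contradiction w≡v w≢v
          ... | there w∈ = w∈

          a = proj₁ (predatorPair v)
          b = proj₂ (predatorPair v)

        predatorPair-bridge : ¬ Star (Edge (map predatorPair others)) a b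
        predatorPair-bridge path = 1+n≰n (+-cancelˡ-≤ l _ _ (begin
          l + suc (length others)        ≡⟨ cong (l +_) (↭-length (↭-sym nonSources↭v∷others)) ⟩
          l + length nonSources          ≡⟨ cong (_+ length nonSources) tight ⟩
          #sources E + length nonSources ≡⟨ #sources+#nonSources≡n ⟩
          n                              ≤⟨ vertices≤components+length others
                                              (Star-Edge-redundant path ∘ connected-by-predatorPairs covers) ⟩
          l + length others              ∎))
          where
          open ≤-Reasoning
          covers : ∀ {z} → ¬ IsSource E z → z ∈ v ∷ others
          covers = ∈-resp-↭ nonSources↭v∷others ∘ ∈-nonSources

        a≢b : a ≢ b
        a≢b a≡b = predatorPair-bridge (subst (Star _ a) a≡b ε)

        predators≡[a,b] : predators v ≡ a ∷ b ∷ []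
        predators≡[a,b] = firstTwo-proper v (predators-length≤2 v) a≢b

        exactly-two-predators : ∃ λ a → ∃ λ b → a ≢ b × Walk E m a v × Walk E m b v ×
                                  (∀ x → Walk E m x v → x ≡ a ⊎ x ≡ b)
        exactly-two-predators =
          a , b , a≢b , predator (here refl) , predator (there (here refl)) , only-a-b
          where
          predator : ∀ {x} → x ∈ a ∷ b ∷ [] → Walk E m x v
          predator = ∈-predators⁻ ∘ subst (_ ∈_) (sym predators≡[a,b])
          only-a-b : ∀ x → Walk E m x v → x ≡ a ⊎ x ≡ b
          only-a-b x x→v with subst (x ∈_) predators≡[a,b] (∈-predators⁺ x→v)
          ... | here x≡a         = inj₁ x≡a
          ... | there (here x≡b) = inj₂ x≡b

        at-most-one-common-predator : ∀ w → w ≢ v → ∀ x y →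
          Walk E m x v → Walk E m x w → Walk E m y v → Walk E m y w → x ≡ y
        at-most-one-common-predator w w≢v x y x→v x→w y→v y→w with x ≟ y
        ... | yes x≡y = x≡y
        ... | no x≢y  = contradiction (Edge-mono pair-w∈ pair-w-joins-a-b ◅ ε) predatorPair-bridge
          where
          pair-w-joins-a-b : Edge [ predatorPair w ] a b
          pair-w-joins-a-b = Edge-[]-ends (predatorPair-covers x≢y x→v y→v) (predatorPair-covers x≢y x→w y→w)
          pair-w∈ : [ predatorPair w ] ⊆ map predatorPair others
          pair-w∈ (here refl) = ∈-map⁺ predatorPair (∈-others (prey-¬IsSource m>0 x→w) w≢v)

lemma2p4 : (n : ℕ) (E : Digraph n) → OutdegPos E → WeaklyConnected E →
    (k m l : ℕ) → k > 0 → m > 0 → #sources E ≡ k →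
    TriangleFree (CompEdge E m) → HasComponents (CompEdge E m) l →
    (l ≥ k) ×
    (l ≡ k →
      ∀ v → ¬ IsSource E v →
        (∃ λ a → ∃ λ b → a ≢ b × Walk E m a v × Walk E m b v ×
            (∀ c → Walk E m c v → c ≡ a ⊎ c ≡ b)) ×
        (∀ w → w ≢ v → ∀ a b →
            Walk E m a v → Walk E m a w → Walk E m b v → Walk E m b w → a ≡ b))
lemma2p4 n E _ _ k m l _ m>0 refl triangle-free (c , _ , components) =
  #sources≤components , λ l≡k v v-prey →
    let open Tight l≡k v-prey in exactly-two-predators , at-most-one-common-predator
  where
  open CompetitionGraph E m
  open TriangleFreeness triangle-free
  open Components m>0 c (λ {x} {y} → proj₁ (components x y))
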